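{- Let $\mathcal{C}$ be a $\mathcal{V}\text{ - }\mathsf{Cat}_{\mathsf{sep}}$-enriched autonomous category. Then the linear $\mathcal{V}\lambda$-theory $\mathrm{Lang}(\mathcal{C})$ is varietal.
   Context: Standing assumptions on $\mathcal{V}$: commutative unital quantale (complete lattice, commutative associative $\otimes$ distributing over joins, unit $k$), integral ($k=\top$), with continuous underlying lattice and a fixed basis $B$ closed under finite joins and $\otimes$ and containing $k$. $\mathcal{V}$-categories $(X,a)$: $a:X\times X\to\mathcal{V}$, $k\le a(x,x)$, $a(x,y)\otimes a(y,z)\le a(x,z)$; separated if $k\le a(x,y)$ and $k\le a(y,x)$ imply $x=y$. A $\mathcal{V}\text{ - }\mathsf{Cat}_{\mathsf{sep}}$-enriched autonomous category is a symmetric monoidal closed (autonomous) category whose hom-sets are small separated $\mathcal{V}$-categories such that composition and the action of $\otimes$ on homs are $\mathcal{V}$-functors (w.r.t. the pointwise tensor $(a\otimes b)((x,y),(x',y'))=a(x,x')\otimes b(y,y')$), and $-\otimes X\dashv X\multimap -$ is an enriched adjunction. Linear $\mathcal{V}\lambda$-theories: over ground types $G$ and operation symbols $\Sigma$ (each $f:A_1,\dots,A_n\to A$, $n\ge1$) one forms linear $\lambda$-terms (types $X\in G$, $I$, $A\otimes B$, $A\multimap B$; terms $f(\vec v)$, variables, $\ast$, $v\ \mathtt{to}\ \ast.\,w$, $v\otimes w$, $\mathtt{pm}\ v\ \mathtt{to}\ x\otimes y.\,w$, $\lambda x.\,v$, $v\,w$, linearly typed); a theory has axioms $Ax$ which are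 $\mathcal{V}$-equations-in-context $\Gamma\rhd v=_q w:A$ with $q\in B$; its theorems are those derivable from $Ax$ and the $\beta\eta$/commuting-conversion equations of linear $\lambda$-calculus by the $\mathcal{V}$-congruence rules (reflexivity with label $\top$, transitivity with label $q\otimes r$, weakening of labels, Archimedean rule, finite joins, compatibility with term constructors and substitution, context permutation). For types $A,B$, the terms $v$ with $x:A\rhd v:B$ form a $\mathcal{V}$-category with $a(v,w)=\bigvee\{q\mid x:A\rhd v=_q w:B$ is a theorem$\}$; its separated quotient (identify $v,w$ when $a(v,w)\ge k$ and $a(w,v)\ge k$) is denoted $\mathcal{C}_T(A,B)$. The theory is varietal if every $\mathcal{C}_T(A,B)$ is small (a set). $\mathrm{Lang}(\mathcal{C})$: ground types are the objects of $\mathcal{C}$; operation symbols are all morphisms of $\mathcal{C}$ together with, for each type $A$, isomorphisms between $A$ and $i(A)$, where $i(I)=\hat I$, $i(X)=X$, $i(A\otimes B)=i(A)\,\hat\otimes\, i(B)$, $i(A\multimap B)=i(A)\,\hat\multimap\, i(B)$ (hats denoting the monoidal closed structure of $\mathcal{C}$); axioms are all $\mathcal{V}$-equations-in-context satisfied by the obvious interpretation in $\mathcal{C}$ (i.e. those with $a(\llbracket v\rrbracket,\llbracket w\rrbracket)\ge q$ in the hom-$\mathcal{V}$-category). -}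

module Defs where

open import Level using (Level; _⊔_; Setω) renaming (suc to lsuc; zero to lzero)
open import Data.Unit using () renaming (⊤ to Unit)
open import Data.Empty using () renaming (⊥ to Empty)
open import Data.Product using (Σ; ∃; _×_; _,_; proj₁; proj₂)
open import Data.Sum using (_⊎_; inj₁; inj₂)
open import Data.List using (List; []; _∷_; [_])
open import Data.List.NonEmpty using (List⁺; toList) renaming (_∷_ to _∷⁺_)
open import Relation.Binary.PropositionalEquality using (_≡_; refl; sym; cong; subst)

record Quantale (v : Level) : Setω where
  infix  4 _≤_
  infixl 7 _⊗_
  field
    Carrier   : Set v
    _≤_       : Carrier → Carrier → Set v
    ≤-refl    : ∀ x → x ≤ x
    ≤-trans   : ∀ {x y z} → x ≤ y → y ≤ z → x ≤ z
    ≤-antisym : ∀ {x y} → x ≤ y → y ≤ x → x ≡ y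
    ⋁         : ∀ {i} → (Carrier → Set i) → Carrier
    ⋁-upper   : ∀ {i} (P : Carrier → Set i) {x} → P x → x ≤ ⋁ P
    ⋁-least   : ∀ {i} (P : Carrier → Set i) {y} → (∀ x → P x → x ≤ y) → ⋁ P ≤ y
    _⊗_       : Carrier → Carrier → Carrier
    k         : Carrier
    ⊗-assoc   : ∀ x y z → (x ⊗ y) ⊗ z ≡ x ⊗ (y ⊗ z)
    ⊗-comm    : ∀ x y → x ⊗ y ≡ y ⊗ x
    ⊗-unitˡ   : ∀ x → k ⊗ x ≡ x
    ⊗-distrib : ∀ {i} x (P : Carrier → Set i) →
                x ⊗ ⋁ P ≡ ⋁ (λ y → ∃ λ z → P z × y ≡ x ⊗ z)

module QuantaleNotions {v : Level} (Q : Quantale v) where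
  open Quantale Q

  ⊤V : Carrier
  ⊤V = ⋁ (λ _ → Unit)

  ⊥V : Carrier
  ⊥V = ⋁ (λ _ → Empty)

  infixl 6 _∨_
  _∨_ : Carrier → Carrier → Carrier
  x ∨ y = ⋁ (λ z → (z ≡ x) ⊎ (z ≡ y))

  Directed : ∀ {i} → (Carrier → Set i) → Set (v ⊔ i)
  Directed D = (∃ λ x → D x) ×
               (∀ x y → D x → D y → ∃ λ z → D z × x ≤ z × y ≤ z)

  infix 4 _≪_
  _≪_ : Carrier → Carrier → Set (lsuc v)
  x ≪ y = ∀ (D : Carrier → Set v) → Directed D → y ≤ ⋁ D →
          ∃ λ d → D d × x ≤ d

record Standing {v : Level} (Q : Quantale v) : Set (lsuc v) where
  open Quantale Q
  open QuantaleNotions Q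
  field
    integral            : k ≡ ⊤V
    continuous-directed : ∀ x → Directed (λ y → y ≪ x)
    continuous          : ∀ x → x ≡ ⋁ (λ y → y ≪ x)
    B                   : Carrier → Set v
    basis-directed      : ∀ x → Directed (λ b → B b × b ≪ x)
    basis-join          : ∀ x → x ≡ ⋁ (λ b → B b × b ≪ x)
    B-⊥                 : B ⊥V
    B-∨                 : ∀ {x y} → B x → B y → B (x ∨ y)
    B-⊗                 : ∀ {x y} → B x → B y → B (x ⊗ y)
    B-k                 : B k

record EnrichedAutonomous {v : Level} (Q : Quantale v) (o ℓ : Level)
       : Set (v ⊔ lsuc (o ⊔ ℓ)) where
  open Quantale Q renaming (_⊗_ to _⊗V_; _≤_ to _≤V_)
  infixr 9 _∘_
  infixr 10 _⊗̂_ _⊗ₘ_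
  infixr 9 _⊸̂_
  field
    Obj    : Set o
    Hom    : Obj → Obj → Set ℓ
    id     : ∀ {X} → Hom X X
    _∘_    : ∀ {X Y Z} → Hom Y Z → Hom X Y → Hom X Z
    identityˡ : ∀ {X Y} (f : Hom X Y) → id ∘ f ≡ f
    identityʳ : ∀ {X Y} (f : Hom X Y) → f ∘ id ≡ f
    assoc  : ∀ {W X Y Z} (f : Hom Y Z) (g : Hom X Y) (h : Hom W X) →
             (f ∘ g) ∘ h ≡ f ∘ (g ∘ h)
    _⊗̂_   : Obj → Obj → Obj
    Î      : Obj
    _⊗ₘ_   : ∀ {X X' Y Y'} → Hom X Y → Hom X' Y' → Hom (X ⊗̂ X') (Y ⊗̂ Y')
    ⊗-id   : ∀ {X Y} → id {X} ⊗ₘ id {Y} ≡ id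
    ⊗-∘    : ∀ {X X' Y Y' Z Z'} (f : Hom Y Z) (f' : Hom Y' Z')
             (g : Hom X Y) (g' : Hom X' Y') →
             (f ∘ g) ⊗ₘ (f' ∘ g') ≡ (f ⊗ₘ f') ∘ (g ⊗ₘ g')
    α      : ∀ {X Y Z} → Hom ((X ⊗̂ Y) ⊗̂ Z) (X ⊗̂ (Y ⊗̂ Z))
    α⁻¹    : ∀ {X Y Z} → Hom (X ⊗̂ (Y ⊗̂ Z)) ((X ⊗̂ Y) ⊗̂ Z)
    α-iso₁ : ∀ {X Y Z} → α⁻¹ ∘ α {X} {Y} {Z} ≡ id
    α-iso₂ : ∀ {X Y Z} → α ∘ α⁻¹ {X} {Y} {Z} ≡ id
    α-nat  : ∀ {X X' Y Y' Z Z'} (f : Hom X X') (g : Hom Y Y') (h : Hom Z Z') →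
             α ∘ ((f ⊗ₘ g) ⊗ₘ h) ≡ (f ⊗ₘ (g ⊗ₘ h)) ∘ α
    lu     : ∀ {X} → Hom (Î ⊗̂ X) X
    lu⁻¹   : ∀ {X} → Hom X (Î ⊗̂ X)
    lu-iso₁ : ∀ {X} → lu⁻¹ ∘ lu {X} ≡ id
    lu-iso₂ : ∀ {X} → lu ∘ lu⁻¹ {X} ≡ id
    lu-nat : ∀ {X Y} (f : Hom X Y) → lu ∘ (id ⊗ₘ f) ≡ f ∘ lu
    ru     : ∀ {X} → Hom (X ⊗̂ Î) X
    ru⁻¹   : ∀ {X} → Hom X (X ⊗̂ Î)
    ru-iso₁ : ∀ {X} → ru⁻¹ ∘ ru {X} ≡ id
    ru-iso₂ : ∀ {X} → ru ∘ ru⁻¹ {X} ≡ id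
    ru-nat : ∀ {X Y} (f : Hom X Y) → ru ∘ (f ⊗ₘ id) ≡ f ∘ ru
    triangle : ∀ {X Y} → (id {X} ⊗ₘ lu {Y}) ∘ α ≡ ru ⊗ₘ id
    pentagon : ∀ {W X Y Z} →
               (id {W} ⊗ₘ α {X} {Y} {Z}) ∘ α ∘ (α ⊗ₘ id) ≡ α ∘ α
    σ      : ∀ {X Y} → Hom (X ⊗̂ Y) (Y ⊗̂ X)
    σ-inv  : ∀ {X Y} → σ ∘ σ {X} {Y} ≡ id
    σ-nat  : ∀ {X X' Y Y'} (f : Hom X X') (g : Hom Y Y') →
             σ ∘ (f ⊗ₘ g) ≡ (g ⊗ₘ f) ∘ σ
    hexagon : ∀ {X Y Z} →
              α {Y} {Z} {X} ∘ σ {X} {Y ⊗̂ Z} ∘ α ≡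
              (id ⊗ₘ σ) ∘ α ∘ (σ ⊗ₘ id)
    _⊸̂_   : Obj → Obj → Obj
    ev     : ∀ {X Y} → Hom ((X ⊸̂ Y) ⊗̂ X) Y
    curry  : ∀ {X Y Z} → Hom (Z ⊗̂ X) Y → Hom Z (X ⊸̂ Y)
    curry-β : ∀ {X Y Z} (f : Hom (Z ⊗̂ X) Y) → ev ∘ (curry f ⊗ₘ id) ≡ f
    curry-η : ∀ {X Y Z} (g : Hom Z (X ⊸̂ Y)) → curry (ev ∘ (g ⊗ₘ id)) ≡ g
    -- enrichment: every hom-set is a separated V-category
    d      : ∀ {X Y} → Hom X Y → Hom X Y → Carrier
    d-refl : ∀ {X Y} (f : Hom X Y) → k ≤V d f f
    d-trans : ∀ {X Y} (f g h : Hom X Y) → d f g ⊗V d g h ≤V d f h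
    d-sep  : ∀ {X Y} {f g : Hom X Y} → k ≤V d f g → k ≤V d g f → f ≡ g
    ∘-Vfun : ∀ {X Y Z} (g g' : Hom Y Z) (f f' : Hom X Y) →
             d g g' ⊗V d f f' ≤V d (g ∘ f) (g' ∘ f')
    ⊗-Vfun : ∀ {X X' Y Y'} (f f' : Hom X Y) (g g' : Hom X' Y') →
             d f f' ⊗V d g g' ≤V d (f ⊗ₘ g) (f' ⊗ₘ g')
    -- the adjunction is enriched: currying is an isomorphism of
    -- hom-V-categories
    curry-Viso : ∀ {X Y Z} (f g : Hom (Z ⊗̂ X) Y) → d (curry f) (curry g) ≡ d f g

infixr 7 _⊗ᵗ_
infixr 6 _⊸ᵗ_
data Ty {g : Level} (G : Set g) : Set g where
  gr    : G → Ty G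
  I     : Ty G
  _⊗ᵗ_  : Ty G → Ty G → Ty G
  _⊸ᵗ_  : Ty G → Ty G → Ty G

-- Contexts are lists of types (variables are positional; the most recently
-- bound variable is at the front).  Γ ≔ Δ ⊎ Ε : Γ is an interleaving of Δ
-- and Ε (linear context splitting).
module Contexts {g : Level} {G : Set g} where
  Ctx : Set g
  Ctx = List (Ty G)

  infix 4 _≔_⊎_
  data _≔_⊎_ : Ctx → Ctx → Ctx → Set g where
    []  : [] ≔ [] ⊎ []
    l   : ∀ {A Γ Δ E} → Γ ≔ Δ ⊎ E → (A ∷ Γ) ≔ (A ∷ Δ) ⊎ E
    r   : ∀ {A Γ Δ E} → Γ ≔ Δ ⊎ E → (A ∷ Γ) ≔ Δ ⊎ (A ∷ E)

  allL : ∀ Γ → Γ ≔ Γ ⊎ []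
  allL []      = []
  allL (A ∷ Γ) = l (allL Γ)

  allR : ∀ Γ → Γ ≔ [] ⊎ Γ
  allR []      = []
  allR (A ∷ Γ) = r (allR Γ)

  swap : ∀ {Γ Δ E} → Γ ≔ Δ ⊎ E → Γ ≔ E ⊎ Δ
  swap []    = []
  swap (l s) = r (swap s)
  swap (r s) = l (swap s)

  idʳ : ∀ {Γ Δ} → Γ ≔ Δ ⊎ [] → Γ ≡ Δ
  idʳ []    = refl
  idʳ (l s) = cong (_ ∷_) (idʳ s)

  assocL : ∀ {Ξ Δ Θ Δ₁ Δ₂} → Ξ ≔ Δ ⊎ Θ → Δ ≔ Δ₁ ⊎ Δ₂ →
           Σ Ctx λ Θ₂ → (Θ₂ ≔ Δ₂ ⊎ Θ) × (Ξ ≔ Δ₁ ⊎ Θ₂)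
  assocL []    []     = [] , [] , []
  assocL (l s) (l s₁) with assocL s s₁
  ... | Θ₂ , τ , τ' = Θ₂ , τ , l τ'
  assocL (l s) (r s₁) with assocL s s₁
  ... | Θ₂ , τ , τ' = _ ∷ Θ₂ , l τ , r τ'
  assocL (r s) s₁ with assocL s s₁
  ... | Θ₂ , τ , τ' = _ ∷ Θ₂ , r τ , r τ'

  assocR₁ : ∀ {Ξ Δ E E₁ E₂} → Ξ ≔ Δ ⊎ E → E ≔ E₁ ⊎ E₂ →
            Σ Ctx λ Ξ₁ → (Ξ₁ ≔ Δ ⊎ E₁) × (Ξ ≔ Ξ₁ ⊎ E₂)
  assocR₁ []    []     = [] , [] , []
  assocR₁ (l σ) s with assocR₁ σ s
  ... | Ξ₁ , p , q = _ ∷ Ξ₁ , l p , l q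
  assocR₁ (r σ) (l s) with assocR₁ σ s
  ... | Ξ₁ , p , q = _ ∷ Ξ₁ , r p , l q
  assocR₁ (r σ) (r s) with assocR₁ σ s
  ... | Ξ₁ , p , q = Ξ₁ , p , r q

  assocR₂ : ∀ {Ξ Δ E E₁ E₂} → Ξ ≔ Δ ⊎ E → E ≔ E₁ ⊎ E₂ →
            Σ Ctx λ Ξ₂ → (Ξ₂ ≔ Δ ⊎ E₂) × (Ξ ≔ E₁ ⊎ Ξ₂)
  assocR₂ []    []     = [] , [] , []
  assocR₂ (l σ) s with assocR₂ σ s
  ... | Ξ₂ , p , q = _ ∷ Ξ₂ , l p , r q
  assocR₂ (r σ) (l s) with assocR₂ σ s
  ... | Ξ₂ , p , q = Ξ₂ , p , l q
  assocR₂ (r σ) (r s) with assocR₂ σ s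
  ... | Ξ₂ , p , q = _ ∷ Ξ₂ , r p , r q

  -- Hole A Γ Δ Ξ : Γ contains a distinguished variable of type A, and Ξ is
  -- obtained from Γ by replacing that variable by the context Δ (the
  -- variables of Δ being interleaved with those following the hole).
  data Hole (A : Ty G) : Ctx → Ctx → Ctx → Set g where
    here  : ∀ {E Δ Ξ} → Ξ ≔ Δ ⊎ E → Hole A (A ∷ E) Δ Ξ
    there : ∀ {C Γ Δ Ξ} → Hole A Γ Δ Ξ → Hole A (C ∷ Γ) Δ (C ∷ Ξ)

  holeSplit : ∀ {A Γ Δ Ξ Γ₁ Γ₂} → Hole A Γ Δ Ξ → Γ ≔ Γ₁ ⊎ Γ₂ →
              (Σ Ctx λ Ξ₁ → Hole A Γ₁ Δ Ξ₁ × (Ξ ≔ Ξ₁ ⊎ Γ₂)) ⊎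
              (Σ Ctx λ Ξ₂ → Hole A Γ₂ Δ Ξ₂ × (Ξ ≔ Γ₁ ⊎ Ξ₂))
  holeSplit (here σ) (l s) with assocR₁ σ s
  ... | Ξ₁ , p , q = inj₁ (Ξ₁ , here p , q)
  holeSplit (here σ) (r s) with assocR₂ σ s
  ... | Ξ₂ , p , q = inj₂ (Ξ₂ , here p , q)
  holeSplit (there h) (l s) with holeSplit h s
  ... | inj₁ (Ξ₁ , h₁ , q) = inj₁ (_ ∷ Ξ₁ , there h₁ , l q)
  ... | inj₂ (Ξ₂ , h₂ , q) = inj₂ (Ξ₂ , h₂ , l q)
  holeSplit (there h) (r s) with holeSplit h s
  ... | inj₁ (Ξ₁ , h₁ , q) = inj₁ (Ξ₁ , h₁ , r q)
  ... | inj₂ (Ξ₂ , h₂ , q) = inj₂ (_ ∷ Ξ₂ , there h₂ , r q)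

record Signature (g s : Level) : Set (lsuc (g ⊔ s)) where
  field
    Gnd : Set g
    Op  : List⁺ (Ty Gnd) → Ty Gnd → Set s

module Terms {g s : Level} (Sg : Signature g s) where
  open Signature Sg public
  open Contexts {g} {Gnd} public

  Type : Set g
  Type = Ty Gnd

  data Tm : Ctx → Type → Set (g ⊔ s)
  data Args : Ctx → List Type → Set (g ⊔ s)

  data Tm where
    var     : ∀ {A} → Tm [ A ] A
    op      : ∀ {As A Γ} → Op As A → Args Γ (toList As) → Tm Γ A
    star    : Tm [] I
    letstar : ∀ {Γ Δ E A} → Γ ≔ Δ ⊎ E → Tm Δ I → Tm E A → Tm Γ A
    pair    : ∀ {Γ Δ E A B} → Γ ≔ Δ ⊎ E → Tm Δ A → Tm E B → Tm Γ (A ⊗ᵗ B)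
    pm      : ∀ {Γ Δ E A B C} → Γ ≔ Δ ⊎ E → Tm Δ (A ⊗ᵗ B) →
              Tm (A ∷ B ∷ E) C → Tm Γ C
              -- pm v to x ⊗ y. w   (x, y bound at the front of the context)
    lam     : ∀ {Γ A B} → Tm (A ∷ Γ) B → Tm Γ (A ⊸ᵗ B)
    app     : ∀ {Γ Δ E A B} → Γ ≔ Δ ⊎ E → Tm Δ (A ⊸ᵗ B) → Tm E A → Tm Γ B

  data Args where
    []   : Args [] []
    cons : ∀ {Γ Δ E A As} → Γ ≔ Δ ⊎ E → Tm Δ A → Args E As → Args Γ (A ∷ As)

  sub     : ∀ {A Γ Δ Ξ B} → Hole A Γ Δ Ξ → Tm Δ A → Tm Γ B → Tm Ξ B
  subArgs : ∀ {A Γ Δ Ξ Bs} → Hole A Γ Δ Ξ → Tm Δ A → Args Γ Bs → Args Ξ Bs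

  sub (here σ) t var = subst (λ Ξ → Tm Ξ _) (sym (idʳ σ)) t
  sub (there ()) t var
  sub h t (op f as) = op f (subArgs h t as)
  sub h t (letstar s u w) with holeSplit h s
  ... | inj₁ (_ , h₁ , q) = letstar q (sub h₁ t u) w
  ... | inj₂ (_ , h₂ , q) = letstar q u (sub h₂ t w)
  sub h t (pair s u w) with holeSplit h s
  ... | inj₁ (_ , h₁ , q) = pair q (sub h₁ t u) w
  ... | inj₂ (_ , h₂ , q) = pair q u (sub h₂ t w)
  sub h t (pm s u w) with holeSplit h s
  ... | inj₁ (_ , h₁ , q) = pm q (sub h₁ t u) w
  ... | inj₂ (_ , h₂ , q) = pm q u (sub (there (there h₂)) t w)
  sub h t (lam w) = lam (sub (there h) t w)
  sub h t (app s u w) with holeSplit h s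
  ... | inj₁ (_ , h₁ , q) = app q (sub h₁ t u) w
  ... | inj₂ (_ , h₂ , q) = app q u (sub h₂ t w)

  subArgs () t []
  subArgs h t (cons s u as) with holeSplit h s
  ... | inj₁ (_ , h₁ , q) = cons q (sub h₁ t u) as
  ... | inj₂ (_ , h₂ , q) = cons q u (subArgs h₂ t as)

  -- β / η / commuting-conversion equations of linear λ-calculus
  -- (each used in both directions, with label ⊤).
  data Conv : ∀ {Γ A} → Tm Γ A → Tm Γ A → Set (g ⊔ s) where
    β⊸  : ∀ {Γ Δ E A B} (sp : Γ ≔ Δ ⊎ E) (t : Tm (A ∷ Δ) B) (u : Tm E A) →
          Conv (app sp (lam t) u) (sub (here (swap sp)) u t)
    η⊸  : ∀ {Γ A B} (t : Tm Γ (A ⊸ᵗ B)) →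
          Conv (lam (app (r (allL Γ)) t var)) t
    βI  : ∀ {Γ A} (t : Tm Γ A) → Conv (letstar (allR Γ) star t) t
    ηI  : ∀ {Ξ Δ Θ B} (sp : Ξ ≔ Δ ⊎ Θ) (v : Tm Δ I) (w : Tm (I ∷ Θ) B) →
          Conv (letstar sp v (sub (here (allR Θ)) star w)) (sub (here sp) v w)
    β⊗  : ∀ {Ξ Δ Θ Δ₁ Δ₂ A B C} (sp : Ξ ≔ Δ ⊎ Θ) (sp₁ : Δ ≔ Δ₁ ⊎ Δ₂)
          (v : Tm Δ₁ A) (w : Tm Δ₂ B) (u : Tm (A ∷ B ∷ Θ) C) →
          Conv (pm sp (pair sp₁ v w) u)
               (sub (here (proj₂ (proj₂ (assocL sp sp₁)))) v
                    (sub (there (here (proj₁ (proj₂ (assocL sp sp₁))))) w u))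
    η⊗  : ∀ {Ξ Δ Θ A B C} (sp : Ξ ≔ Δ ⊎ Θ) (v : Tm Δ (A ⊗ᵗ B))
          (u : Tm ((A ⊗ᵗ B) ∷ Θ) C) →
          Conv (pm sp v (sub (here (l (l (allR Θ)))) (pair (l (r [])) var var) u))
               (sub (here sp) v u)
    ccI : ∀ {Ξ Δ Θ Δ₁ Δ₂ C D} (sp : Ξ ≔ Δ ⊎ Θ) (sp₁ : Δ ≔ Δ₁ ⊎ Δ₂)
          (v : Tm Δ₁ I) (w : Tm Δ₂ C) (u : Tm (C ∷ Θ) D) →
          Conv (sub (here sp) (letstar sp₁ v w) u)
               (letstar (proj₂ (proj₂ (assocL sp sp₁))) v
                        (sub (here (proj₁ (proj₂ (assocL sp sp₁)))) w u))
    cc⊗ : ∀ {Ξ Δ Θ Δ₁ Δ₂ A B C D} (sp : Ξ ≔ Δ ⊎ Θ) (sp₁ : Δ ≔ Δ₁ ⊎ Δ₂)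
          (v : Tm Δ₁ (A ⊗ᵗ B)) (w : Tm (A ∷ B ∷ Δ₂) C) (u : Tm (C ∷ Θ) D) →
          Conv (sub (here sp) (pm sp₁ v w) u)
               (pm (proj₂ (proj₂ (assocL sp sp₁))) v
                   (sub (here (l (l (proj₁ (proj₂ (assocL sp sp₁)))))) w u))

module Theory {v g s a : Level} (Q : Quantale v) (St : Standing Q)
              (Sg : Signature g s)
              (Ax : ∀ {Γ A} → Quantale.Carrier Q → Terms.Tm Sg Γ A →
                    Terms.Tm Sg Γ A → Set a) where
  open Quantale Q
  open QuantaleNotions Q
  open Standing St
  open Terms Sg

  data Thm : ∀ {Γ A} → Carrier → Tm Γ A → Tm Γ A → Set (lsuc v ⊔ g ⊔ s ⊔ a)
  data ArgsThm : ∀ {Γ As} → Carrier → Args Γ As → Args Γ As →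
                 Set (lsuc v ⊔ g ⊔ s ⊔ a)

  data Thm where
    ax      : ∀ {Γ A q} {t u : Tm Γ A} → B q → Ax q t u → Thm q t u
    conv    : ∀ {Γ A} {t u : Tm Γ A} → Conv t u → Thm ⊤V t u
    conv⁻   : ∀ {Γ A} {t u : Tm Γ A} → Conv t u → Thm ⊤V u t
    refl    : ∀ {Γ A} {t : Tm Γ A} → Thm ⊤V t t
    trans   : ∀ {Γ A q q'} {t u w : Tm Γ A} → Thm q t u → Thm q' u w →
              Thm (q ⊗ q') t w
    weak    : ∀ {Γ A q q'} {t u : Tm Γ A} → B q' → q' ≤ q → Thm q t u →
              Thm q' t u
    arch    : ∀ {Γ A q} {t u : Tm Γ A} → B q →
              (∀ q' → B q' → q' ≪ q → Thm q' t u) → Thm q t u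
    join⊥   : ∀ {Γ A} {t u : Tm Γ A} → Thm ⊥V t u
    join∨   : ∀ {Γ A q q'} {t u : Tm Γ A} → Thm q t u → Thm q' t u →
              Thm (q ∨ q') t u
    cong-op : ∀ {Γ As A q} {f : Op As A} {ts us : Args Γ (toList As)} →
              ArgsThm q ts us → Thm q (op f ts) (op f us)
    cong-letstar : ∀ {Γ Δ E A q q'} (sp : Γ ≔ Δ ⊎ E) {t t' : Tm Δ I}
              {u u' : Tm E A} → Thm q t t' → Thm q' u u' →
              Thm (q ⊗ q') (letstar sp t u) (letstar sp t' u')
    cong-pair : ∀ {Γ Δ E A B' q q'} (sp : Γ ≔ Δ ⊎ E) {t t' : Tm Δ A}
              {u u' : Tm E B'} → Thm q t t' → Thm q' u u' →
              Thm (q ⊗ q') (pair sp t u) (pair sp t' u')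
    cong-pm : ∀ {Γ Δ E A B' C q q'} (sp : Γ ≔ Δ ⊎ E) {t t' : Tm Δ (A ⊗ᵗ B')}
              {u u' : Tm (A ∷ B' ∷ E) C} → Thm q t t' → Thm q' u u' →
              Thm (q ⊗ q') (pm sp t u) (pm sp t' u')
    cong-lam : ∀ {Γ A B' q} {t t' : Tm (A ∷ Γ) B'} → Thm q t t' →
              Thm q (lam t) (lam t')
    cong-app : ∀ {Γ Δ E A B' q q'} (sp : Γ ≔ Δ ⊎ E) {t t' : Tm Δ (A ⊸ᵗ B')}
              {u u' : Tm E A} → Thm q t t' → Thm q' u u' →
              Thm (q ⊗ q') (app sp t u) (app sp t' u')
    subst-rule : ∀ {A Θ Δ Ξ B' q q'} (h : Hole A Θ Δ Ξ) {t t' : Tm Δ A}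
              {u u' : Tm Θ B'} → Thm q t t' → Thm q' u u' →
              Thm (q ⊗ q') (sub h t u) (sub h t' u')
    -- context permutation (moving one variable to another position)
    perm    : ∀ {A Γ Γ' B' q} (h : Hole A Γ [ A ] Γ') {t u : Tm Γ B'} →
              Thm q t u → Thm q (sub h var t) (sub h var u)

  data ArgsThm where
    []   : ArgsThm k [] []
    cons : ∀ {Γ Δ E A As q q'} (sp : Γ ≔ Δ ⊎ E) {t t' : Tm Δ A}
           {ts ts' : Args E As} → Thm q t t' → ArgsThm q' ts ts' →
           ArgsThm (q ⊗ q') (cons sp t ts) (cons sp t' ts')

  dT : ∀ {A B'} → Tm [ A ] B' → Tm [ A ] B' → Carrier
  dT t u = ⋁ (λ q → Thm q t u)

  -- the equivalence relation whose quotient is C_T(A,B)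
  _∼_ : ∀ {A B'} → Tm [ A ] B' → Tm [ A ] B' → Set v
  t ∼ u = (k ≤ dT t u) × (k ≤ dT u t)

  -- C_T(A,B) is small (a set, i.e. ℓ-small): it is the image of a type in
  -- Set ℓ, i.e. there is a map from a small type onto the quotient.
  IsSmall : ∀ (ℓ : Level) (A B' : Type) → Set (lsuc ℓ ⊔ v ⊔ g ⊔ s)
  IsSmall ℓ A B' = Σ (Set ℓ) λ S → Σ (S → Tm [ A ] B') λ f →
                   ∀ (t : Tm [ A ] B') → Σ S λ x → f x ∼ t

  Varietal : (ℓ : Level) → Set (lsuc ℓ ⊔ v ⊔ g ⊔ s)
  Varietal ℓ = ∀ (A B' : Type) → IsSmall ℓ A B'

module Lang {v o ℓ : Level} (Q : Quantale v) (St : Standing Q)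
            (𝒞 : EnrichedAutonomous Q o ℓ) where
  open Quantale Q
  open Standing St
  open EnrichedAutonomous 𝒞

  i : Ty Obj → Obj
  i (gr X)    = X
  i I         = Î
  i (A ⊗ᵗ B') = i A ⊗̂ i B'
  i (A ⊸ᵗ B') = i A ⊸̂ i B'

  data LangOp : List⁺ (Ty Obj) → Ty Obj → Set (o ⊔ ℓ) where
    mor  : ∀ {X Y} → Hom X Y → LangOp (gr X ∷⁺ []) (gr Y)
    iso  : ∀ A → LangOp (A ∷⁺ []) (gr (i A))
    iso⁻ : ∀ A → LangOp (gr (i A) ∷⁺ []) A

  LangSig : Signature o (o ⊔ ℓ)
  LangSig = record { Gnd = Obj ; Op = LangOp }

  open Terms LangSig

  ⟦_⟧ᶜ : Ctx → Obj
  ⟦ [] ⟧ᶜ    = Î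
  ⟦ A ∷ Γ ⟧ᶜ = i A ⊗̂ ⟦ Γ ⟧ᶜ

  split : ∀ {Γ Δ E} → Γ ≔ Δ ⊎ E → Hom ⟦ Γ ⟧ᶜ (⟦ Δ ⟧ᶜ ⊗̂ ⟦ E ⟧ᶜ)
  split []    = lu⁻¹
  split (l s) = α⁻¹ ∘ (id ⊗ₘ split s)
  split (r s) = α ∘ (σ ⊗ₘ id) ∘ α⁻¹ ∘ (id ⊗ₘ split s)

  ⟦_⟧ᵒ : ∀ {As A} → LangOp As A → Hom ⟦ toList As ⟧ᶜ (i A)
  ⟦ mor f ⟧ᵒ  = f ∘ ru
  ⟦ iso A ⟧ᵒ  = ru
  ⟦ iso⁻ A ⟧ᵒ = ru

  ⟦_⟧ : ∀ {Γ A} → Tm Γ A → Hom ⟦ Γ ⟧ᶜ (i A)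
  ⟦_⟧ᵃ : ∀ {Γ As} → Args Γ As → Hom ⟦ Γ ⟧ᶜ ⟦ As ⟧ᶜ

  ⟦ var ⟧             = ru
  ⟦ op f ts ⟧         = ⟦ f ⟧ᵒ ∘ ⟦ ts ⟧ᵃ
  ⟦ star ⟧            = id
  ⟦ letstar sp t u ⟧  = ⟦ u ⟧ ∘ lu ∘ (⟦ t ⟧ ⊗ₘ id) ∘ split sp
  ⟦ pair sp t u ⟧     = (⟦ t ⟧ ⊗ₘ ⟦ u ⟧) ∘ split sp
  ⟦ pm sp t u ⟧       = ⟦ u ⟧ ∘ α ∘ (⟦ t ⟧ ⊗ₘ id) ∘ split sp
  ⟦ lam t ⟧           = curry (⟦ t ⟧ ∘ σ)
  ⟦ app sp t u ⟧      = ev ∘ (⟦ t ⟧ ⊗ₘ ⟦ u ⟧) ∘ split sp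

  ⟦ [] ⟧ᵃ             = id
  ⟦ cons sp t ts ⟧ᵃ   = (⟦ t ⟧ ⊗ₘ ⟦ ts ⟧ᵃ) ∘ split sp

  LangAx : ∀ {Γ A} → Carrier → Tm Γ A → Tm Γ A → Set v
  LangAx q t u = B q × (q ≤ d ⟦ t ⟧ ⟦ u ⟧)

  open Theory Q St LangSig LangAx public

{-# OPTIONS --safe #-}
-- Two terms x : A ▷ t, u : B with the same interpretation in 𝒞 are provably
-- equal with label k, since that equation is itself an axiom of Lang(𝒞).
-- So C_T(A,B) is covered by the hom-set 𝒞(i A, i B): a morphism h is named by
-- the term iso⁻(h(iso x)), whose interpretation is h ∘ ru, and every term t
-- has the same interpretation as the name of ⟦ t ⟧ ∘ ru⁻¹.
module Submission where

open import Defs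
open import Data.List using ([]; [_])
open import Data.Product using (_,_)
open import Relation.Binary.PropositionalEquality
  using (_≡_; sym; cong; cong₂; subst; module ≡-Reasoning)

module MonoidalLemmas {v o ℓ} {Q : Quantale v} (𝒞 : EnrichedAutonomous Q o ℓ) where
  open EnrichedAutonomous 𝒞
  open ≡-Reasoning

  left-inverse≡right-inverse : ∀ {X Y} {f : Hom X Y} {g h : Hom Y X} →
                               g ∘ f ≡ id → f ∘ h ≡ id → g ≡ h
  left-inverse≡right-inverse {f = f} {g} {h} gf≡id fh≡id = begin
    g            ≡⟨ sym (identityʳ g) ⟩
    g ∘ id       ≡⟨ cong (g ∘_) (sym fh≡id) ⟩
    g ∘ f ∘ h    ≡⟨ sym (assoc g f h) ⟩
    (g ∘ f) ∘ h  ≡⟨ cong (_∘ h) gf≡id ⟩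
    id ∘ h       ≡⟨ identityˡ h ⟩
    h            ∎

  ⊗ₘ-inverse : ∀ {X X' Y Y'} {f : Hom X Y} {f' : Hom Y X}
               {g : Hom X' Y'} {g' : Hom Y' X'} →
               f' ∘ f ≡ id → g' ∘ g ≡ id → (f' ⊗ₘ g') ∘ (f ⊗ₘ g) ≡ id
  ⊗ₘ-inverse {f = f} {f'} {g} {g'} f'f≡id g'g≡id = begin
    (f' ⊗ₘ g') ∘ (f ⊗ₘ g)  ≡⟨ sym (⊗-∘ f' g' f g) ⟩
    (f' ∘ f) ⊗ₘ (g' ∘ g)   ≡⟨ cong₂ _⊗ₘ_ f'f≡id g'g≡id ⟩
    id ⊗ₘ id               ≡⟨ ⊗-id ⟩
    id                     ∎

  -- Both sides are inverse to ru ⊗ₘ id = (id ⊗ₘ lu) ∘ α.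
  triangle⁻¹ : ∀ {X Y} → α⁻¹ ∘ (id {X} ⊗ₘ lu⁻¹ {Y}) ≡ ru⁻¹ ⊗ₘ id
  triangle⁻¹ = sym (left-inverse≡right-inverse
    (⊗ₘ-inverse ru-iso₁ (identityˡ id))
    (begin
      (ru ⊗ₘ id) ∘ α⁻¹ ∘ (id ⊗ₘ lu⁻¹)        ≡⟨ cong (_∘ α⁻¹ ∘ (id ⊗ₘ lu⁻¹)) (sym triangle) ⟩
      ((id ⊗ₘ lu) ∘ α) ∘ α⁻¹ ∘ (id ⊗ₘ lu⁻¹)  ≡⟨ assoc _ _ _ ⟩
      (id ⊗ₘ lu) ∘ α ∘ α⁻¹ ∘ (id ⊗ₘ lu⁻¹)    ≡⟨ cong ((id ⊗ₘ lu) ∘_) (sym (assoc _ _ _)) ⟩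
      (id ⊗ₘ lu) ∘ (α ∘ α⁻¹) ∘ (id ⊗ₘ lu⁻¹)  ≡⟨ cong (λ e → (id ⊗ₘ lu) ∘ e ∘ (id ⊗ₘ lu⁻¹)) α-iso₂ ⟩
      (id ⊗ₘ lu) ∘ id ∘ (id ⊗ₘ lu⁻¹)         ≡⟨ cong ((id ⊗ₘ lu) ∘_) (identityˡ _) ⟩
      (id ⊗ₘ lu) ∘ (id ⊗ₘ lu⁻¹)              ≡⟨ ⊗ₘ-inverse (identityˡ id) lu-iso₂ ⟩
      id                                     ∎))

  ru∘α⁻¹∘id⊗lu⁻¹ : ∀ {X} → ru ∘ α⁻¹ ∘ (id ⊗ₘ lu⁻¹) ≡ id {X ⊗̂ Î}
  ru∘α⁻¹∘id⊗lu⁻¹ = begin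
    ru ∘ α⁻¹ ∘ (id ⊗ₘ lu⁻¹)  ≡⟨ cong (ru ∘_) triangle⁻¹ ⟩
    ru ∘ (ru⁻¹ ⊗ₘ id)        ≡⟨ ru-nat ru⁻¹ ⟩
    ru⁻¹ ∘ ru                ≡⟨ ru-iso₁ ⟩
    id                       ∎

  -- α⁻¹ ∘ (id ⊗ₘ lu⁻¹) is split (l []), so the left side is the interpretation
  -- of a unary operation symbol interpreted by ru, applied to a term denoting f.
  ru∘⊗ₘid∘α⁻¹∘id⊗lu⁻¹ : ∀ {X Y} (f : Hom (X ⊗̂ Î) Y) →
                        ru ∘ (f ⊗ₘ id) ∘ α⁻¹ ∘ (id ⊗ₘ lu⁻¹) ≡ f
  ru∘⊗ₘid∘α⁻¹∘id⊗lu⁻¹ f = begin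
    ru ∘ (f ⊗ₘ id) ∘ α⁻¹ ∘ (id ⊗ₘ lu⁻¹)    ≡⟨ sym (assoc _ _ _) ⟩
    (ru ∘ (f ⊗ₘ id)) ∘ α⁻¹ ∘ (id ⊗ₘ lu⁻¹)  ≡⟨ cong (_∘ α⁻¹ ∘ (id ⊗ₘ lu⁻¹)) (ru-nat f) ⟩
    (f ∘ ru) ∘ α⁻¹ ∘ (id ⊗ₘ lu⁻¹)          ≡⟨ assoc _ _ _ ⟩
    f ∘ ru ∘ α⁻¹ ∘ (id ⊗ₘ lu⁻¹)            ≡⟨ cong (f ∘_) ru∘α⁻¹∘id⊗lu⁻¹ ⟩
    f ∘ id                                 ≡⟨ identityʳ f ⟩
    f                                      ∎

module LangLemmas {v o ℓ} (Q : Quantale v) (St : Standing Q)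
                  (𝒞 : EnrichedAutonomous Q o ℓ) where
  open Quantale Q using (k; _≤_; ⋁-upper)
  open Standing St using (B-k)
  open EnrichedAutonomous 𝒞
  open Lang Q St 𝒞
  open Terms LangSig
  open MonoidalLemmas 𝒞
  open ≡-Reasoning

  iso-var : ∀ A → Tm [ A ] (gr (i A))
  iso-var A = op (iso A) (cons (l []) var [])

  reify : ∀ A B' → Hom (i A) (i B') → Tm [ A ] B'
  reify A B' h = op (iso⁻ B') (cons (l []) (op (mor h) (cons (l []) (iso-var A) [])) [])

  ⟦reify⟧ : ∀ A B' (h : Hom (i A) (i B')) → ⟦ reify A B' h ⟧ ≡ h ∘ ru
  ⟦reify⟧ A B' h = begin
    ⟦ reify A B' h ⟧
      ≡⟨ ru∘⊗ₘid∘α⁻¹∘id⊗lu⁻¹ _ ⟩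
    (h ∘ ru) ∘ (⟦ iso-var A ⟧ ⊗ₘ id) ∘ α⁻¹ ∘ (id ⊗ₘ lu⁻¹)
      ≡⟨ assoc _ _ _ ⟩
    h ∘ ru ∘ (⟦ iso-var A ⟧ ⊗ₘ id) ∘ α⁻¹ ∘ (id ⊗ₘ lu⁻¹)
      ≡⟨ cong (h ∘_) (ru∘⊗ₘid∘α⁻¹∘id⊗lu⁻¹ _) ⟩
    h ∘ ⟦ iso-var A ⟧
      ≡⟨ cong (h ∘_) (ru∘⊗ₘid∘α⁻¹∘id⊗lu⁻¹ ru) ⟩
    h ∘ ru
      ∎

  ⟦reify⟧-section : ∀ {A B'} (t : Tm [ A ] B') → ⟦ reify A B' (⟦ t ⟧ ∘ ru⁻¹) ⟧ ≡ ⟦ t ⟧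
  ⟦reify⟧-section {A} {B'} t = begin
    ⟦ reify A B' (⟦ t ⟧ ∘ ru⁻¹) ⟧  ≡⟨ ⟦reify⟧ A B' (⟦ t ⟧ ∘ ru⁻¹) ⟩
    (⟦ t ⟧ ∘ ru⁻¹) ∘ ru            ≡⟨ assoc _ _ _ ⟩
    ⟦ t ⟧ ∘ ru⁻¹ ∘ ru              ≡⟨ cong (⟦ t ⟧ ∘_) ru-iso₁ ⟩
    ⟦ t ⟧ ∘ id                     ≡⟨ identityʳ _ ⟩
    ⟦ t ⟧                          ∎

  ⟦⟧≡⇒k≤dT : ∀ {A B'} {t u : Tm [ A ] B'} → ⟦ t ⟧ ≡ ⟦ u ⟧ → k ≤ dT t u
  ⟦⟧≡⇒k≤dT {t = t} ⟦t⟧≡⟦u⟧ =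
    ⋁-upper _ (ax B-k (B-k , subst (λ f → k ≤ d ⟦ t ⟧ f) ⟦t⟧≡⟦u⟧ (d-refl ⟦ t ⟧)))

  ⟦⟧≡⇒∼ : ∀ {A B'} {t u : Tm [ A ] B'} → ⟦ t ⟧ ≡ ⟦ u ⟧ → t ∼ u
  ⟦⟧≡⇒∼ ⟦t⟧≡⟦u⟧ = ⟦⟧≡⇒k≤dT ⟦t⟧≡⟦u⟧ , ⟦⟧≡⇒k≤dT (sym ⟦t⟧≡⟦u⟧)

theorem3p17 : ∀ {v o ℓ} (Q : Quantale v) (St : Standing Q)
              (𝒞 : EnrichedAutonomous Q o ℓ) →
              Lang.Varietal Q St 𝒞 ℓ
theorem3p17 Q St 𝒞 A B' =
  Hom (i A) (i B') , reify A B' , λ t → ⟦ t ⟧ ∘ ru⁻¹ , ⟦⟧≡⇒∼ (⟦reify⟧-section t)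
  where
  open EnrichedAutonomous 𝒞
  open Lang Q St 𝒞
  open LangLemmas Q St 𝒞
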